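{- Let $A$, $B$, $X$ be finite subsets of some universal set. Then $$|A\triangle X|+|B\triangle X|\le|A|+|B|+2|A\triangle B\triangle X|,$$ where $\triangle$ denotes symmetric difference. -}

module Defs where

open import Data.Fin.Subset using (Subset; _∪_; _─_)

infixl 6 _△_
_△_ : ∀ {n} → Subset n → Subset n → Subset n
A △ B = (A ─ B) ∪ (B ─ A)

module Submission where

-- Both _△_ and ∣_∣ act coordinatewise on subsets of Fin n:
-- the first coordinate of A △ X is the exclusive-or of the first coordinates
-- of A and X, and ∣_∣ adds up the 0/1 weights of the coordinates.  So both
-- sides of the inequality are sums over the n coordinates, and it suffices
--   * to peel off the first coordinate of a symmetric difference (△-∷) and
--     of a cardinality (card-∷),
--   * to check the inequality for a single point, i.e. for the eight ways a
--     point can lie in A, B and X (one-point-case),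
--   * to add that one-point inequality to the inequality between the totals
--     over the remaining points (add-point).

open import Defs
open import Data.Bool using (_xor_)
open import Data.Nat using (ℕ; _+_; _*_; _≤_; zero; suc; z≤n; s≤s)
open import Data.Nat.Properties using (+-mono-≤; ≤-refl; module ≤-Reasoning)
open import Data.Nat.Tactic.RingSolver using (solve-∀)
open import Data.Fin.Subset using (Subset; ∣_∣; inside; outside; Side)
open import Data.Vec using ([]; _∷_)
open import Relation.Binary.PropositionalEquality
  using (_≡_; refl; subst₂; cong; cong₂; trans)

weight : Side → ℕ
weight outside = 0
weight inside  = 1

card-∷ : ∀ {n} (s : Side) (S : Subset n) → ∣ s ∷ S ∣ ≡ weight s + ∣ S ∣
card-∷ outside S = refl
card-∷ inside  S = refl

△-∷ : ∀ {n} (a x : Side) (A X : Subset n) → (a ∷ A) △ (x ∷ X) ≡ (a xor x) ∷ (A △ X)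
△-∷ outside outside A X = refl
△-∷ outside inside  A X = refl
△-∷ inside  outside A X = refl
△-∷ inside  inside  A X = refl

card-△-∷ : ∀ {n} (a x : Side) (A X : Subset n) →
  ∣ (a ∷ A) △ (x ∷ X) ∣ ≡ weight (a xor x) + ∣ A △ X ∣
card-△-∷ a x A X = trans (cong ∣_∣ (△-∷ a x A X)) (card-∷ (a xor x) (A △ X))

card-△△-∷ : ∀ {n} (a b x : Side) (A B X : Subset n) →
  ∣ (a ∷ A) △ (b ∷ B) △ (x ∷ X) ∣ ≡ weight ((a xor b) xor x) + ∣ A △ B △ X ∣
card-△△-∷ a b x A B X =
  trans (cong (λ S → ∣ S △ (x ∷ X) ∣) (△-∷ a b A B)) (card-△-∷ (a xor b) x (A △ B) X)

one-point-case : (a b x : Side) →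
  weight (a xor x) + weight (b xor x) ≤ weight a + weight b + 2 * weight ((a xor b) xor x)
one-point-case outside outside outside = z≤n
one-point-case outside outside inside  = ≤-refl
one-point-case outside inside  outside = s≤s z≤n
one-point-case outside inside  inside  = ≤-refl
one-point-case inside  outside outside = s≤s z≤n
one-point-case inside  outside inside  = ≤-refl
one-point-case inside  inside  outside = ≤-refl
one-point-case inside  inside  inside  = z≤n

add-point : ∀ (a b x : Side) {p q r s t} → p + q ≤ r + s + 2 * t →
  (weight (a xor x) + p) + (weight (b xor x) + q)
    ≤ (weight a + r) + (weight b + s) + 2 * (weight ((a xor b) xor x) + t)
add-point a b x {p} {q} {r} {s} {t} h =
  subst₂ _≤_ (interchange (weight (a xor x)) (weight (b xor x)) p q)
             (regroup (weight a) (weight b) (weight ((a xor b) xor x)) r s t)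
             (+-mono-≤ (one-point-case a b x) h)
  where
  interchange : ∀ p q p′ q′ → (p + q) + (p′ + q′) ≡ (p + p′) + (q + q′)
  interchange = solve-∀
  regroup : ∀ r s t r′ s′ t′ →
    (r + s + 2 * t) + (r′ + s′ + 2 * t′) ≡ (r + r′) + (s + s′) + 2 * (t + t′)
  regroup = solve-∀

lemma4p2 : (n : ℕ) (A B X : Subset n) →
    ∣ A △ X ∣ + ∣ B △ X ∣ ≤ ∣ A ∣ + ∣ B ∣ + 2 * ∣ A △ B △ X ∣
lemma4p2 zero [] [] [] = z≤n
lemma4p2 (suc n) (a ∷ A) (b ∷ B) (x ∷ X) = begin
  ∣ (a ∷ A) △ (x ∷ X) ∣ + ∣ (b ∷ B) △ (x ∷ X) ∣
    ≡⟨ cong₂ _+_ (card-△-∷ a x A X) (card-△-∷ b x B X) ⟩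
  (weight (a xor x) + ∣ A △ X ∣) + (weight (b xor x) + ∣ B △ X ∣)
    ≤⟨ add-point a b x (lemma4p2 n A B X) ⟩
  (weight a + ∣ A ∣) + (weight b + ∣ B ∣) + 2 * (weight ((a xor b) xor x) + ∣ A △ B △ X ∣)
    ≡⟨ cong₂ _+_ (cong₂ _+_ (card-∷ a A) (card-∷ b B)) (cong (2 *_) (card-△△-∷ a b x A B X)) ⟨
  ∣ a ∷ A ∣ + ∣ b ∷ B ∣ + 2 * ∣ (a ∷ A) △ (b ∷ B) △ (x ∷ X) ∣
    ∎
  where open ≤-Reasoning
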